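{- A permutation $\pi\in\mathscr{G}_n$ is an involution if and only if it is of the form \[ \pi=\mathrm{id}_{k_1}\oplus\big(\mathrm{id}_{k_2}\ominus\mathrm{id}_{k_2}\big)\oplus\mathrm{id}_{k_3} \] for some integers $k_1,k_2,k_3\ge 0$ with $k_1+2k_2+k_3=n$. Moreover, if $i_n$ denotes the number of Grassmannian involutions of size $n$, then $i_n=\frac{n^2+3}{4}$ if $n$ is odd and $i_n=\frac{n^2+4}{4}$ if $n$ is even.
   Context: A permutation is Grassmannian if it has at most one descent (a position $i$ with $\pi(i)>\pi(i+1)$); $\mathscr{G}_n$ is the set of Grassmannian permutations of $[n]$. $\mathrm{id}_k=12\cdots k$, with $\mathrm{id}_0$ the empty word. For permutations $\pi_1,\pi_2$, the direct sum $\pi_1\oplus\pi_2$ lists the entries of $\pi_1$ followed by the entries of $\pi_2$ each increased by $|\pi_1|$; the skew sum $\pi_1\ominus\pi_2$ lists the entries of $\pi_1$ each increased by $|\pi_2|$, followed by the entries of $\pi_2$. -}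

module Defs where

open import Data.Nat using (ℕ; zero; suc; _+_; _*_; _≤_; _<_; _>_)
open import Data.List using (List; []; _∷_; map; upTo; length; _++_)
open import Data.Product using (_×_)
open import Relation.Binary.PropositionalEquality using (_≡_)
open import Data.List.Relation.Binary.Permutation.Propositional using (_↭_)

-- Permutations are written in one-line notation as lists of naturals
-- with values in [n] = {1,…,n}.

idp : ℕ → List ℕ
idp k = map suc (upTo k)

IsPerm : ℕ → List ℕ → Set
IsPerm n π = π ↭ idp n

-- π(i) for 1-based position i (junk value 0 outside 1..length π)
at : List ℕ → ℕ → ℕ
at []       _             = 0
at (x ∷ xs) zero          = 0
at (x ∷ xs) (suc zero)    = x
at (x ∷ xs) (suc (suc i)) = at xs (suc i)

_⊕_ : List ℕ → List ℕ → List ℕ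
π₁ ⊕ π₂ = π₁ ++ map (_+ length π₁) π₂

_⊖_ : List ℕ → List ℕ → List ℕ
π₁ ⊖ π₂ = map (_+ length π₂) π₁ ++ π₂

infixl 6 _⊕_ _⊖_

Descent : List ℕ → ℕ → Set
Descent π i = (1 ≤ i) × (i < length π) × (at π i > at π (suc i))

Grassmannian : List ℕ → Set
Grassmannian π = ∀ i j → Descent π i → Descent π j → i ≡ j

Involution : List ℕ → Set
Involution π = ∀ i → 1 ≤ i → i ≤ length π → at π (at π i) ≡ i

{-# OPTIONS --safe #-}
-- A Grassmannian permutation p of [n] is increasing on [1, d] and on [d + 1, n], where d is its
-- descent (or on all of [1, n] if there is none). An increasing map on [1, d] with p 1 ≥ 1 has
-- j ≤ p j, and one on [d + 1, n] with p n ≤ n has p j ≤ j; for an involution this fixes every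
-- point that p keeps inside its half. Without a descent p is therefore the identity. Otherwise
-- write p (d + 1) = k₁ + 1 ≤ d and d = k₁ + 1 + r. Then p (k₁ + 1) = d + 1, and comparing the
-- increments of p along [k₁ + 1, d] and along [d + 1, p d] gives p d = d + 1 + r. An increasing
-- map whose increment over an interval equals the interval's length is a translation there, so
-- p shifts [k₁ + 1, d] up and [d + 1, d + 1 + r] down by r + 1 and fixes all other points:
-- π = id_k₁ ⊕ (id_(r+1) ⊖ id_(r+1)) ⊕ id_k₃. Conversely all these are Grassmannian involutions;
-- for k₂ ≥ 1 the triple is recovered from π (k₁ + 1 is the least moved point, sent to
-- k₁ + k₂ + 1), while k₂ = 0 always gives the identity. Counting triples with k₂ ≥ 1 gives
-- i (n + 2) = i n + n + 1, whose solution is the stated formula.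
module Submission where

open import Defs
open import Data.Nat using (ℕ; zero; suc; _+_; _*_; _∸_; _%_; _≤_; _<_; _>_; z≤n; s≤s; z<s; _≤?_; _<?_)
open import Data.Nat.Properties
open import Data.Nat.DivMod using ([m+n]%n≡m%n)
open import Data.Nat.Tactic.RingSolver using (solve-∀)
open import Data.Product using (_×_; _,_; ∃-syntax; proj₁; proj₂)
open import Data.Sum using (_⊎_; inj₁; inj₂)
open import Data.List using (List; []; _∷_; length; map; _++_; applyUpTo)
open import Data.List.Properties
  using (map-++; map-upTo; length-++; length-map; length-applyUpTo; ++-assoc; ++-identityʳ)
open import Data.List.Membership.Propositional using (_∈_)
open import Data.List.Membership.Propositional.Properties
  using (∈-map⁻; ∈-map⁺; ∈-++⁻; ∈-++⁺ˡ; ∈-++⁺ʳ; ∈-applyUpTo⁺; ∈-applyUpTo⁻)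
open import Data.List.Relation.Unary.Any using (here; there)
import Data.List.Relation.Unary.All as All
open import Data.List.Relation.Unary.AllPairs using (AllPairs; []; _∷_)
import Data.List.Relation.Unary.AllPairs.Properties as AllPairs
open import Data.List.Relation.Unary.Unique.Propositional using (Unique)
import Data.List.Relation.Unary.Unique.Propositional.Properties as Unique
open import Data.List.Relation.Binary.Permutation.Propositional using (↭-refl; module PermutationReasoning)
open import Data.List.Relation.Binary.Permutation.Propositional.Properties
  using (++⁺ˡ; ++⁺ʳ; ++-comm; ↭-length; ∈-resp-↭)
open import Function using (_∘_)
open import Function.Bundles using (_⇔_; mk⇔)
open import Relation.Binary using (tri<; tri≈; tri>)
open import Relation.Binary.PropositionalEquality
open import Relation.Nullary using (¬_; yes; no; contradiction)
open import Relation.Nullary.Decidable using (_×-dec_)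

consecutive : ℕ → ℕ → List ℕ
consecutive a zero    = []
consecutive a (suc k) = suc a ∷ consecutive (suc a) k

length-consecutive : ∀ a k → length (consecutive a k) ≡ k
length-consecutive a zero    = refl
length-consecutive a (suc k) = cong suc (length-consecutive (suc a) k)

applyUpTo-consecutive : ∀ {f : ℕ → ℕ} a k → (∀ i → f i ≡ suc (a + i)) →
                        applyUpTo f k ≡ consecutive a k
applyUpTo-consecutive a zero    f≗ = refl
applyUpTo-consecutive a (suc k) f≗ =
  cong₂ _∷_ (trans (f≗ 0) (cong suc (+-identityʳ a)))
            (applyUpTo-consecutive (suc a) k (λ i → trans (f≗ (suc i)) (cong suc (+-suc a i))))

idp≡consecutive : ∀ k → idp k ≡ consecutive 0 k
idp≡consecutive k = trans (map-upTo suc k) (applyUpTo-consecutive 0 k (λ _ → refl))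

length-idp : ∀ n → length (idp n) ≡ n
length-idp n = trans (cong length (idp≡consecutive n)) (length-consecutive 0 n)

map-+-consecutive : ∀ c a k → map (_+ c) (consecutive a k) ≡ consecutive (a + c) k
map-+-consecutive c a zero    = refl
map-+-consecutive c a (suc k) = cong (suc (a + c) ∷_) (map-+-consecutive c (suc a) k)

consecutive-++ : ∀ a j k → consecutive a (j + k) ≡ consecutive a j ++ consecutive (a + j) k
consecutive-++ a zero    k = cong (λ b → consecutive b k) (sym (+-identityʳ a))
consecutive-++ a (suc j) k = cong (suc a ∷_) (begin
  consecutive (suc a) (j + k)
    ≡⟨ consecutive-++ (suc a) j k ⟩
  consecutive (suc a) j ++ consecutive (suc a + j) k
    ≡⟨ cong (λ b → consecutive (suc a) j ++ consecutive b k) (+-suc a j) ⟨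
  consecutive (suc a) j ++ consecutive (a + suc j) k ∎)
  where open ≡-Reasoning

∈-consecutive⁻ : ∀ {x} a k → x ∈ consecutive a k → a < x × x ≤ a + k
∈-consecutive⁻ a (suc k) (here refl) = ≤-refl , subst (suc a ≤_) (sym (+-suc a k)) (s≤s (m≤m+n a k))
∈-consecutive⁻ {x} a (suc k) (there x∈) with ∈-consecutive⁻ (suc a) k x∈
... | a<x , x≤ = <-trans (n<1+n a) a<x , subst (x ≤_) (sym (+-suc a k)) x≤

consecutive-sorted : ∀ a k → AllPairs _<_ (consecutive a k)
consecutive-sorted a zero    = []
consecutive-sorted a (suc k) =
  All.tabulate (λ x∈ → proj₁ (∈-consecutive⁻ (suc a) k x∈)) ∷ consecutive-sorted (suc a) k

consecutive-++-sorted : ∀ {a c} j k → a + j ≤ c → AllPairs _<_ (consecutive a j ++ consecutive c k)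
consecutive-++-sorted {a} {c} j k a+j≤c =
  AllPairs.++⁺ (consecutive-sorted a j) (consecutive-sorted c k)
    (All.tabulate λ x∈ → All.tabulate λ y∈ →
       <-≤-trans (≤-trans (s≤s (proj₂ (∈-consecutive⁻ a j x∈))) (s≤s a+j≤c)) (proj₁ (∈-consecutive⁻ c k y∈)))

at-++ˡ : ∀ (xs ys : List ℕ) {i} → i < length xs → at (xs ++ ys) (suc i) ≡ at xs (suc i)
at-++ˡ (x ∷ xs) ys {zero}  _         = refl
at-++ˡ (x ∷ xs) ys {suc i} (s≤s i<) = at-++ˡ xs ys i<

at-++ʳ : ∀ (xs ys : List ℕ) i → at (xs ++ ys) (suc (length xs + i)) ≡ at ys (suc i)
at-++ʳ []       ys i = refl
at-++ʳ (x ∷ xs) ys i = at-++ʳ xs ys i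

at-∈ : ∀ (xs : List ℕ) {i} → i < length xs → at xs (suc i) ∈ xs
at-∈ (x ∷ xs) {zero}  _        = here refl
at-∈ (x ∷ xs) {suc i} (s≤s i<) = there (at-∈ xs i<)

at-extensional : ∀ (xs ys : List ℕ) → length xs ≡ length ys →
                 (∀ {i} → i < length xs → at xs (suc i) ≡ at ys (suc i)) → xs ≡ ys
at-extensional []       []       _   _  = refl
at-extensional (x ∷ xs) (y ∷ ys) len at≗ =
  cong₂ _∷_ (at≗ z<s) (at-extensional xs ys (suc-injective len) (λ i< → at≗ (s≤s i<)))

sorted⇒at-< : ∀ {xs : List ℕ} {i} → AllPairs _<_ xs → suc i < length xs → at xs (suc i) < at xs (suc (suc i))
sorted⇒at-< {x ∷ y ∷ xs} {zero}  ((x<y All.∷ _) ∷ _) _        = x<y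
sorted⇒at-< {x ∷ xs}     {suc i} (_ ∷ sorted)          (s≤s i<) = sorted⇒at-< sorted i<

sorted-++⇒descent≡length : ∀ {xs ys : List ℕ} {i} → AllPairs _<_ xs → AllPairs _<_ ys →
                           Descent (xs ++ ys) i → i ≡ length xs
sorted-++⇒descent≡length {xs} {ys} {suc i} xs-sorted ys-sorted (_ , i<len , drop)
  with <-cmp (suc i) (length xs)
... | tri≈ _ i≡len _ = i≡len
... | tri< i<xs _ _ = contradiction
  (subst₂ _<_ (sym (at-++ˡ xs ys (<-trans (n<1+n i) i<xs))) (sym (at-++ˡ xs ys i<xs))
          (sorted⇒at-< xs-sorted i<xs))
  (<-asym drop)
... | tri> _ _ xs<i with m≤n⇒∃[o]m+o≡n (≤-pred xs<i)
...   | j , refl = contradiction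
  (subst₂ _<_ (sym (at-++ʳ xs ys j))
              (sym (trans (cong (λ k → at (xs ++ ys) (suc k)) (sym (+-suc (length xs) j)))
                          (at-++ʳ xs ys (suc j))))
              (sorted⇒at-< ys-sorted (+-cancelˡ-< (length xs) (suc j) (length ys)
                (subst₂ _≤_ (cong suc (sym (+-suc (length xs) j))) (length-++ xs) i<len))))
  (<-asym drop)

sorted-++⇒grassmannian : ∀ {xs ys : List ℕ} → AllPairs _<_ xs → AllPairs _<_ ys → Grassmannian (xs ++ ys)
sorted-++⇒grassmannian xs-sorted ys-sorted i j i-descent j-descent =
  trans (sorted-++⇒descent≡length xs-sorted ys-sorted i-descent)
        (sym (sorted-++⇒descent≡length xs-sorted ys-sorted j-descent))

Translates : (ℕ → ℕ) → ℕ → ℕ → ℕ → Set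
Translates p i j m = ∀ {t} → t < m → p (i + t) ≡ j + t

at-consecutive : ∀ a k → Translates (at (consecutive a k)) 1 (suc a) k
at-consecutive a (suc k) {zero}  _        = cong suc (sym (+-identityʳ a))
at-consecutive a (suc k) {suc t} (s≤s t<) = trans (at-consecutive (suc a) k t<) (cong suc (sym (+-suc a t)))

translates-++ˡ : ∀ (xs ys : List ℕ) {i j m} → i + m ≤ length xs →
                 Translates (at xs) (suc i) j m → Translates (at (xs ++ ys)) (suc i) j m
translates-++ˡ xs ys {i} i+m≤ tr t<m = trans (at-++ˡ xs ys (<-≤-trans (+-monoʳ-< i t<m) i+m≤)) (tr t<m)

translates-++ʳ : ∀ (xs ys : List ℕ) {i j k m} → length xs + i ≡ k →
                 Translates (at ys) (suc i) j m → Translates (at (xs ++ ys)) (suc k) j m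
translates-++ʳ xs ys {i} refl tr {t} t<m =
  trans (cong (λ k → at (xs ++ ys) (suc k)) (+-assoc (length xs) i t)) (trans (at-++ʳ xs ys (i + t)) (tr t<m))

data Block (k₁ k₂ k₃ : ℕ) : ℕ → Set where
  head    : ∀ {t} → t < k₁ → Block k₁ k₂ k₃ (suc t)
  rising  : ∀ {t} → t < k₂ → Block k₁ k₂ k₃ (suc k₁ + t)
  falling : ∀ {t} → t < k₂ → Block k₁ k₂ k₃ (suc k₁ + k₂ + t)
  tail    : ∀ {t} → t < k₃ → Block k₁ k₂ k₃ (suc k₁ + k₂ + k₂ + t)

<-+⇒<⊎≡+ : ∀ a {b i} → i < a + b → i < a ⊎ ∃[ t ] (t < b × a + t ≡ i)
<-+⇒<⊎≡+ a {b} {i} i<a+b with i <? a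
... | yes i<a = inj₁ i<a
... | no  i≮a with m≤n⇒∃[o]m+o≡n (≮⇒≥ i≮a)
...   | t , a+t≡i = inj₂ (t , +-cancelˡ-< a t b (subst (_< a + b) (sym a+t≡i) i<a+b) , a+t≡i)

block : ∀ k₁ k₂ k₃ {i} → i < k₁ + k₂ + k₂ + k₃ → Block k₁ k₂ k₃ (suc i)
block k₁ k₂ k₃ i< with <-+⇒<⊎≡+ (k₁ + k₂ + k₂) i<
... | inj₂ (t , t< , refl) = tail t<
... | inj₁ i< with <-+⇒<⊎≡+ (k₁ + k₂) i<
...   | inj₂ (t , t< , refl) = falling t<
...   | inj₁ i< with <-+⇒<⊎≡+ k₁ i<
...     | inj₂ (t , t< , refl) = rising t<
...     | inj₁ i< = head i<

image : ∀ {k₁ k₂ k₃ i} → Block k₁ k₂ k₃ i → ℕ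
image           (head {t} _)    = suc t
image {k₁} {k₂} (rising {t} _)  = suc k₁ + k₂ + t
image {k₁}      (falling {t} _) = suc k₁ + t
image {k₁} {k₂} (tail {t} _)    = suc k₁ + k₂ + k₂ + t

reflect : ∀ {k₁ k₂ k₃ i} (b : Block k₁ k₂ k₃ i) → Block k₁ k₂ k₃ (image b)
reflect (head t<)    = head t<
reflect (rising t<)  = falling t<
reflect (falling t<) = rising t<
reflect (tail t<)    = tail t<

image-reflect : ∀ {k₁ k₂ k₃ i} (b : Block k₁ k₂ k₃ i) → image (reflect b) ≡ i
image-reflect (head _)    = refl
image-reflect (rising _)  = refl
image-reflect (falling _) = refl
image-reflect (tail _)    = refl

record BlockPattern (p : ℕ → ℕ) (k₁ k₂ k₃ : ℕ) : Set where
  field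
    head-fixed    : Translates p 1 1 k₁
    rising-shift  : Translates p (suc k₁) (suc k₁ + k₂) k₂
    falling-shift : Translates p (suc k₁ + k₂) (suc k₁) k₂
    tail-fixed    : Translates p (suc k₁ + k₂ + k₂) (suc k₁ + k₂ + k₂) k₃

  maps-to-image : ∀ {i} (b : Block k₁ k₂ k₃ i) → p i ≡ image b
  maps-to-image (head t<)    = head-fixed t<
  maps-to-image (rising t<)  = rising-shift t<
  maps-to-image (falling t<) = falling-shift t<
  maps-to-image (tail t<)    = tail-fixed t<

  involutive : ∀ {i} → i < k₁ + k₂ + k₂ + k₃ → p (p (suc i)) ≡ suc i
  involutive {i} i< = begin
    p (p (suc i))      ≡⟨ cong p (maps-to-image b) ⟩
    p (image b)        ≡⟨ maps-to-image (reflect b) ⟩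
    image (reflect b)  ≡⟨ image-reflect b ⟩
    suc i              ∎
    where
    open ≡-Reasoning
    b : Block k₁ k₂ k₃ (suc i)
    b = block k₁ k₂ k₃ i<

blockPattern-unique : ∀ {p q k₁ k₂ k₃} → BlockPattern p k₁ k₂ k₃ → BlockPattern q k₁ k₂ k₃ →
                      ∀ {i} → i < k₁ + k₂ + k₂ + k₃ → p (suc i) ≡ q (suc i)
blockPattern-unique {k₁ = k₁} {k₂} {k₃} p-pattern q-pattern {i} i< =
  trans (BlockPattern.maps-to-image p-pattern b) (sym (BlockPattern.maps-to-image q-pattern b))
  where
  b : Block k₁ k₂ k₃ (suc i)
  b = block k₁ k₂ k₃ i<

blockPattern-moves : ∀ {p k₁ m k₃} → BlockPattern p k₁ (suc m) k₃ → p (suc k₁) ≡ suc k₁ + suc m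
blockPattern-moves {p} {k₁} pat =
  trans (cong p (sym (+-identityʳ (suc k₁)))) (trans (BlockPattern.rising-shift pat z<s) (+-identityʳ _))

blockPattern-head-maximal : ∀ {p k₁ m k₃ k₁′ k₂′ k₃′} →
  BlockPattern p k₁ (suc m) k₃ → BlockPattern p k₁′ k₂′ k₃′ → k₁′ ≤ k₁
blockPattern-head-maximal {k₁ = k₁} pat pat′ = ≮⇒≥ λ k₁<k₁′ →
  m+1+n≢m (suc k₁) (trans (sym (blockPattern-moves pat)) (BlockPattern.head-fixed pat′ k₁<k₁′))

blockPattern-shape-unique : ∀ {p k₁ m k₃ k₁′ m′ k₃′} →
  BlockPattern p k₁ (suc m) k₃ → BlockPattern p k₁′ (suc m′) k₃′ → k₁ ≡ k₁′ × m ≡ m′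
blockPattern-shape-unique {k₁ = k₁} {m} {m′ = m′} pat pat′
  with ≤-antisym (blockPattern-head-maximal pat′ pat) (blockPattern-head-maximal pat pat′)
... | refl = refl , suc-injective (+-cancelˡ-≡ (suc k₁) (suc m) (suc m′)
                                      (trans (sym (blockPattern-moves pat)) (blockPattern-moves pat′)))

blockPermutation : ℕ → ℕ → ℕ → List ℕ
blockPermutation k₁ k₂ k₃ = idp k₁ ⊕ (idp k₂ ⊖ idp k₂) ⊕ idp k₃

blockRuns : ℕ → ℕ → ℕ → List ℕ
blockRuns k₁ k₂ k₃ =
  (consecutive 0 k₁ ++ (consecutive (k₁ + k₂) k₂ ++ consecutive k₁ k₂)) ++ consecutive (k₁ + k₂ + k₂) k₃

module _ (k₁ k₂ k₃ : ℕ) where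
  private
    A B C D P : List ℕ
    A = consecutive 0 k₁
    B = consecutive (k₁ + k₂) k₂
    C = consecutive k₁ k₂
    D = consecutive (k₁ + k₂ + k₂) k₃
    P = A ++ (B ++ C)

    length-P : length P ≡ k₁ + k₂ + k₂
    length-P = begin
      length (A ++ (B ++ C))                ≡⟨ length-++ A ⟩
      length A + length (B ++ C)            ≡⟨ cong (length A +_) (length-++ B) ⟩
      length A + (length B + length C)
        ≡⟨ cong₂ (λ a b → a + (b + length C)) (length-consecutive 0 k₁) (length-consecutive (k₁ + k₂) k₂) ⟩
      k₁ + (k₂ + length C)                  ≡⟨ cong (λ c → k₁ + (k₂ + c)) (length-consecutive k₁ k₂) ⟩
      k₁ + (k₂ + k₂)                        ≡⟨ +-assoc k₁ k₂ k₂ ⟨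
      k₁ + k₂ + k₂                          ∎
      where open ≡-Reasoning

    idp⊕idp⊖idp≡P : idp k₁ ⊕ (idp k₂ ⊖ idp k₂) ≡ P
    idp⊕idp⊖idp≡P = begin
      idp k₁ ⊕ (idp k₂ ⊖ idp k₂)
        ≡⟨ cong₂ (λ xs ys → xs ⊕ (ys ⊖ ys)) (idp≡consecutive k₁) (idp≡consecutive k₂) ⟩
      A ⊕ (map (_+ length C₀) C₀ ++ C₀)
        ≡⟨ cong (λ l → A ⊕ (map (_+ l) C₀ ++ C₀)) (length-consecutive 0 k₂) ⟩
      A ⊕ (map (_+ k₂) C₀ ++ C₀)
        ≡⟨ cong (λ xs → A ⊕ (xs ++ C₀)) (map-+-consecutive k₂ 0 k₂) ⟩
      A ++ map (_+ length A) (consecutive k₂ k₂ ++ C₀)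
        ≡⟨ cong (λ l → A ++ map (_+ l) (consecutive k₂ k₂ ++ C₀)) (length-consecutive 0 k₁) ⟩
      A ++ map (_+ k₁) (consecutive k₂ k₂ ++ C₀)
        ≡⟨ cong (A ++_) (map-++ (_+ k₁) (consecutive k₂ k₂) C₀) ⟩
      A ++ (map (_+ k₁) (consecutive k₂ k₂) ++ map (_+ k₁) C₀)
        ≡⟨ cong₂ (λ xs ys → A ++ (xs ++ ys)) (map-+-consecutive k₁ k₂ k₂) (map-+-consecutive k₁ 0 k₂) ⟩
      A ++ (consecutive (k₂ + k₁) k₂ ++ C)
        ≡⟨ cong (λ a → A ++ (consecutive a k₂ ++ C)) (+-comm k₂ k₁) ⟩
      P ∎
      where
      open ≡-Reasoning
      C₀ : List ℕ
      C₀ = consecutive 0 k₂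

  blockPermutation≡blockRuns : blockPermutation k₁ k₂ k₃ ≡ blockRuns k₁ k₂ k₃
  blockPermutation≡blockRuns = begin
    blockPermutation k₁ k₂ k₃                  ≡⟨ cong₂ _⊕_ idp⊕idp⊖idp≡P (idp≡consecutive k₃) ⟩
    P ++ map (_+ length P) (consecutive 0 k₃)  ≡⟨ cong (P ++_) (map-+-consecutive (length P) 0 k₃) ⟩
    P ++ consecutive (length P) k₃             ≡⟨ cong (λ a → P ++ consecutive a k₃) length-P ⟩
    P ++ D                                     ∎
    where open ≡-Reasoning

  length-blockRuns : length (blockRuns k₁ k₂ k₃) ≡ k₁ + k₂ + k₂ + k₃
  length-blockRuns = trans (length-++ P) (cong₂ _+_ length-P (length-consecutive (k₁ + k₂ + k₂) k₃))

  blockRuns-pattern : BlockPattern (at (blockRuns k₁ k₂ k₃)) k₁ k₂ k₃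
  blockRuns-pattern = record
    { head-fixed    = translates-++ˡ P D (≤-trans (m≤m+n k₁ (k₂ + k₂)) (≤-reflexive (sym length-P′)))
                        (translates-++ˡ A (B ++ C) (≤-reflexive (sym (length-consecutive 0 k₁)))
                          (at-consecutive 0 k₁))
    ; rising-shift  = translates-++ˡ P D (≤-trans (m≤m+n (k₁ + k₂) k₂) (≤-reflexive (sym length-P)))
                        (translates-++ʳ A (B ++ C) (trans (+-identityʳ _) (length-consecutive 0 k₁))
                          (translates-++ˡ B C (≤-reflexive (sym (length-consecutive (k₁ + k₂) k₂)))
                            (at-consecutive (k₁ + k₂) k₂)))
    ; falling-shift = translates-++ˡ P D (≤-reflexive (sym length-P))
                        (translates-++ʳ A (B ++ C) (cong (_+ k₂) (length-consecutive 0 k₁))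
                          (translates-++ʳ B C (trans (+-identityʳ _) (length-consecutive (k₁ + k₂) k₂))
                            (at-consecutive k₁ k₂)))
    ; tail-fixed    = translates-++ʳ P D (trans (+-identityʳ _) length-P) (at-consecutive (k₁ + k₂ + k₂) k₃)
    }
    where
    length-P′ : length P ≡ k₁ + (k₂ + k₂)
    length-P′ = trans length-P (+-assoc k₁ k₂ k₂)

  blockRuns-grassmannian : Grassmannian (blockRuns k₁ k₂ k₃)
  blockRuns-grassmannian =
    subst Grassmannian (sym regroup)
      (sorted-++⇒grassmannian (consecutive-++-sorted k₁ k₂ (m≤m+n k₁ k₂))
                              (consecutive-++-sorted k₂ k₃ (m≤m+n (k₁ + k₂) k₂)))
    where
    regroup : (A ++ (B ++ C)) ++ D ≡ (A ++ B) ++ (C ++ D)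
    regroup = trans (++-assoc A (B ++ C) D) (trans (cong (A ++_) (++-assoc B C D)) (sym (++-assoc A B (C ++ D))))

  blockRuns-isPerm : IsPerm (k₁ + k₂ + k₂ + k₃) (blockRuns k₁ k₂ k₃)
  blockRuns-isPerm = begin
    (A ++ (B ++ C)) ++ D                 ↭⟨ ++⁺ʳ D (++⁺ˡ A (++-comm B C)) ⟩
    (A ++ (C ++ B)) ++ D                 ≡⟨ cong (_++ D) (sym (++-assoc A C B)) ⟩
    ((A ++ C) ++ B) ++ D                 ≡⟨ cong (λ xs → (xs ++ B) ++ D) (sym (consecutive-++ 0 k₁ k₂)) ⟩
    (consecutive 0 (k₁ + k₂) ++ B) ++ D  ≡⟨ cong (_++ D) (sym (consecutive-++ 0 (k₁ + k₂) k₂)) ⟩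
    consecutive 0 (k₁ + k₂ + k₂) ++ D    ≡⟨ sym (consecutive-++ 0 (k₁ + k₂ + k₂) k₃) ⟩
    consecutive 0 (k₁ + k₂ + k₂ + k₃)    ≡⟨ sym (idp≡consecutive _) ⟩
    idp (k₁ + k₂ + k₂ + k₃)              ∎
    where open PermutationReasoning

+-2*-unfold : ∀ k₁ k₂ k₃ → k₁ + 2 * k₂ + k₃ ≡ k₁ + k₂ + k₂ + k₃
+-2*-unfold = solve-∀

blockPermutation-isPerm : ∀ k₁ k₂ k₃ → IsPerm (k₁ + 2 * k₂ + k₃) (blockPermutation k₁ k₂ k₃)
blockPermutation-isPerm k₁ k₂ k₃ rewrite blockPermutation≡blockRuns k₁ k₂ k₃ | +-2*-unfold k₁ k₂ k₃ =
  blockRuns-isPerm k₁ k₂ k₃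

blockPermutation-grassmannian : ∀ k₁ k₂ k₃ → Grassmannian (blockPermutation k₁ k₂ k₃)
blockPermutation-grassmannian k₁ k₂ k₃ rewrite blockPermutation≡blockRuns k₁ k₂ k₃ =
  blockRuns-grassmannian k₁ k₂ k₃

blockPermutation-involution : ∀ k₁ k₂ k₃ → Involution (blockPermutation k₁ k₂ k₃)
blockPermutation-involution k₁ k₂ k₃ rewrite blockPermutation≡blockRuns k₁ k₂ k₃ = λ where
  (suc i) _ i<len → BlockPattern.involutive (blockRuns-pattern k₁ k₂ k₃)
                      (subst (suc i ≤_) (length-blockRuns k₁ k₂ k₃) i<len)

blockPermutation-pattern : ∀ k₁ k₂ k₃ → BlockPattern (at (blockPermutation k₁ k₂ k₃)) k₁ k₂ k₃
blockPermutation-pattern k₁ k₂ k₃ rewrite blockPermutation≡blockRuns k₁ k₂ k₃ = blockRuns-pattern k₁ k₂ k₃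

length-blockPermutation : ∀ k₁ k₂ k₃ → length (blockPermutation k₁ k₂ k₃) ≡ k₁ + k₂ + k₂ + k₃
length-blockPermutation k₁ k₂ k₃ rewrite blockPermutation≡blockRuns k₁ k₂ k₃ = length-blockRuns k₁ k₂ k₃

blockPermutation-injective : ∀ {k₁ m k₃ k₁′ m′ k₃′} →
  blockPermutation k₁ (suc m) k₃ ≡ blockPermutation k₁′ (suc m′) k₃′ → (k₁ , m , k₃) ≡ (k₁′ , m′ , k₃′)
blockPermutation-injective {k₁} {m} {k₃} {k₁′} {m′} {k₃′} π≡π′
  with blockPattern-shape-unique
         (subst (λ π → BlockPattern (at π) k₁ (suc m) k₃) π≡π′ (blockPermutation-pattern k₁ (suc m) k₃))
         (blockPermutation-pattern k₁′ (suc m′) k₃′)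
... | refl , refl = cong (λ k₃ → k₁ , m , k₃) (+-cancelˡ-≡ (k₁ + suc m + suc m) k₃ k₃′ (begin
  k₁ + suc m + suc m + k₃                   ≡⟨ length-blockPermutation k₁ (suc m) k₃ ⟨
  length (blockPermutation k₁ (suc m) k₃)   ≡⟨ cong length π≡π′ ⟩
  length (blockPermutation k₁ (suc m) k₃′)  ≡⟨ length-blockPermutation k₁ (suc m) k₃′ ⟩
  k₁ + suc m + suc m + k₃′                  ∎))
  where open ≡-Reasoning

blockPermutation-emptyMiddle : ∀ k₁ k₃ → blockPermutation k₁ 0 k₃ ≡ idp (k₁ + k₃)
blockPermutation-emptyMiddle k₁ k₃ = begin
  blockPermutation k₁ 0 k₃
    ≡⟨ blockPermutation≡blockRuns k₁ 0 k₃ ⟩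
  (consecutive 0 k₁ ++ []) ++ consecutive (k₁ + 0 + 0) k₃
    ≡⟨ cong₂ (λ xs a → xs ++ consecutive a k₃) (++-identityʳ _) (trans (+-identityʳ _) (+-identityʳ k₁)) ⟩
  consecutive 0 k₁ ++ consecutive k₁ k₃
    ≡⟨ consecutive-++ 0 k₁ k₃ ⟨
  consecutive 0 (k₁ + k₃)
    ≡⟨ idp≡consecutive (k₁ + k₃) ⟨
  idp (k₁ + k₃) ∎
  where open ≡-Reasoning

idp≡blockPermutation : ∀ n → idp n ≡ blockPermutation n 0 0
idp≡blockPermutation n = sym (trans (blockPermutation-emptyMiddle n 0) (cong idp (+-identityʳ n)))

idp≢blockPermutation : ∀ {n k₁ m k₃} → k₁ + 2 * suc m + k₃ ≡ n → idp n ≢ blockPermutation k₁ (suc m) k₃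
idp≢blockPermutation {n} {k₁} {m} {k₃} total idp≡ = <⇒≱ k₁<n (blockPattern-head-maximal
  (blockPermutation-pattern k₁ (suc m) k₃)
  (subst (λ π → BlockPattern (at π) n 0 0) (trans (sym (idp≡blockPermutation n)) idp≡)
         (blockPermutation-pattern n 0 0)))
  where
  k₁<n : k₁ < n
  k₁<n = subst (k₁ <_) total (≤-trans (m<m+n k₁ (s≤s z≤n)) (m≤m+n (k₁ + 2 * suc m) k₃))

IncreasingOn : (ℕ → ℕ) → ℕ → ℕ → Set
IncreasingOn p l r = ∀ {i} → l ≤ i → i < r → p i < p (suc i)

module _ {p : ℕ → ℕ} {l r : ℕ} (increasing : IncreasingOn p l r) where

  increasingOn⇒+-≤ : ∀ {i} s → l ≤ i → i + s ≤ r → p i + s ≤ p (i + s)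
  increasingOn⇒+-≤ {i} zero    _   _      = ≤-reflexive (trans (+-identityʳ (p i)) (cong p (sym (+-identityʳ i))))
  increasingOn⇒+-≤ {i} (suc s) l≤i i+s<r = begin
    p i + suc s       ≡⟨ +-suc (p i) s ⟩
    suc (p i + s)     ≤⟨ s≤s (increasingOn⇒+-≤ s l≤i (≤-trans (n≤1+n _) i+s<r′)) ⟩
    suc (p (i + s))   ≤⟨ increasing (≤-trans l≤i (m≤m+n i s)) i+s<r′ ⟩
    p (suc (i + s))   ≡⟨ cong p (+-suc i s) ⟨
    p (i + suc s)     ∎
    where
    open ≤-Reasoning
    i+s<r′ : i + s < r
    i+s<r′ = subst (_≤ r) (+-suc i s) i+s<r

  increasingOn⇒< : ∀ {i j} → l ≤ i → i < j → j ≤ r → p i < p j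
  increasingOn⇒< {i} l≤i i<j j≤r with m≤n⇒∃[o]m+o≡n i<j
  ... | k , refl = begin-strict
    p i               <⟨ m<m+n (p i) z<s ⟩
    p i + suc k       ≤⟨ increasingOn⇒+-≤ (suc k) l≤i (subst (_≤ r) (sym (+-suc i k)) j≤r) ⟩
    p (i + suc k)     ≡⟨ cong p (+-suc i k) ⟩
    p (suc i + k)     ∎
    where open ≤-Reasoning

  increasingOn⇒deflationary : p r ≤ r → ∀ {j} → l ≤ j → j ≤ r → p j ≤ j
  increasingOn⇒deflationary pr≤r {j} l≤j j≤r with m≤n⇒∃[o]m+o≡n j≤r
  ... | s , refl = +-cancelʳ-≤ s (p j) j (≤-trans (increasingOn⇒+-≤ s l≤j ≤-refl) pr≤r)

  increasingOn⇒translates : ∀ {i m} → l ≤ i → i + m ≤ r → p (i + m) ≤ p i + m → Translates p i (p i) (suc m)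
  increasingOn⇒translates {i} l≤i i+m≤r upper {t} (s≤s t≤m) with m≤n⇒∃[o]m+o≡n t≤m
  ... | u , refl = ≤-antisym
    (+-cancelʳ-≤ u (p (i + t)) (p i + t) (begin
      p (i + t) + u   ≤⟨ increasingOn⇒+-≤ u (≤-trans l≤i (m≤m+n i t)) i+t+u≤r ⟩
      p (i + t + u)   ≡⟨ cong p (+-assoc i t u) ⟩
      p (i + (t + u)) ≤⟨ upper ⟩
      p i + (t + u)   ≡⟨ +-assoc (p i) t u ⟨
      p i + t + u     ∎))
    (increasingOn⇒+-≤ t l≤i (≤-trans (m≤m+n (i + t) u) i+t+u≤r))
    where
    open ≤-Reasoning
    i+t+u≤r : i + t + u ≤ r
    i+t+u≤r = ≤-trans (≤-reflexive (+-assoc i t u)) i+m≤r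

increasingOn⇒inflationary : ∀ {p r} → IncreasingOn p 1 r → 1 ≤ p 1 → ∀ {j} → 1 ≤ j → j ≤ r → j ≤ p j
increasingOn⇒inflationary {p} increasing 1≤p1 {suc t} _ j≤r =
  ≤-trans (+-monoˡ-≤ t 1≤p1) (increasingOn⇒+-≤ increasing t ≤-refl j≤r)

-- Descent π i unfolds to DescentOn (at π) (length π) i.
DescentOn : (ℕ → ℕ) → ℕ → ℕ → Set
DescentOn p n i = 1 ≤ i × i < n × p i > p (suc i)

HasBlockPattern : (ℕ → ℕ) → ℕ → Set
HasBlockPattern p n = ∃[ k₁ ] ∃[ k₂ ] ∃[ k₃ ] (k₁ + k₂ + k₂ + k₃ ≡ n × BlockPattern p k₁ k₂ k₃)

module InvolutionOn {p : ℕ → ℕ} {n : ℕ}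
  (bounded    : ∀ {i} → 1 ≤ i → i ≤ n → 1 ≤ p i × p i ≤ n)
  (involutive : ∀ {i} → 1 ≤ i → i ≤ n → p (p i) ≡ i)
  where

  increasing⇒hasBlockPattern : IncreasingOn p 1 n → HasBlockPattern p n
  increasing⇒hasBlockPattern increasing =
    n , 0 , 0 , trans (+-identityʳ _) (trans (+-identityʳ _) (+-identityʳ n)) , record
      { head-fixed    = λ {t} t<n → ≤-antisym
          (increasingOn⇒deflationary increasing (proj₂ (bounded (≤-trans (s≤s z≤n) t<n) ≤-refl)) (s≤s z≤n) t<n)
          (increasingOn⇒inflationary increasing (proj₁ (bounded ≤-refl (≤-trans (s≤s z≤n) t<n))) (s≤s z≤n) t<n)
      ; rising-shift  = λ ()
      ; falling-shift = λ ()
      ; tail-fixed    = λ ()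
      }

  descent-value≤ : ∀ {d} → 1 ≤ d → d < n → p (suc d) < p d → IncreasingOn p (suc d) n → p (suc d) ≤ d
  descent-value≤ {d} 1≤d d<n drop increasing-after with p (suc d) ≤? d
  ... | yes p[d+1]≤d = p[d+1]≤d
  ... | no  p[d+1]≰d = contradiction
    (begin-strict
      p (suc d)     <⟨ increasingOn⇒< increasing-after ≤-refl d+1<p[d] (proj₂ (bounded 1≤d (<⇒≤ d<n))) ⟩
      p (p d)       ≡⟨ involutive 1≤d (<⇒≤ d<n) ⟩
      d             ∎)
    (<-asym d<p[d+1])
    where
    open ≤-Reasoning
    d<p[d+1] : d < p (suc d)
    d<p[d+1] = ≰⇒> p[d+1]≰d
    d+1<p[d] : suc d < p d
    d+1<p[d] = <-≤-trans (s≤s d<p[d+1]) drop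

  module Descent (k₁ r : ℕ)
    (increasing-before : IncreasingOn p 1 (suc k₁ + r))
    (increasing-after  : IncreasingOn p (suc (suc k₁ + r)) n)
    (d<n               : suc k₁ + r < n)
    (p[d+1]≡k₁+1       : p (suc (suc k₁ + r)) ≡ suc k₁)
    where

    d : ℕ
    d = suc k₁ + r

    p[d]≤n : p d ≤ n
    p[d]≤n = proj₂ (bounded (s≤s z≤n) (<⇒≤ d<n))

    p[p[d]]≡d : p (p d) ≡ d
    p[p[d]]≡d = involutive (s≤s z≤n) (<⇒≤ d<n)

    p[k₁+1]≡d+1 : p (suc k₁) ≡ suc d
    p[k₁+1]≡d+1 = trans (cong p (sym p[d+1]≡k₁+1)) (involutive (s≤s z≤n) d<n)

    d+1+r≤p[d] : suc d + r ≤ p d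
    d+1+r≤p[d] = subst (λ x → x + r ≤ p d) p[k₁+1]≡d+1 (increasingOn⇒+-≤ increasing-before r (s≤s z≤n) ≤-refl)

    p[d]≡d+1+r : p d ≡ suc d + r
    p[d]≡d+1+r with m≤n⇒∃[o]m+o≡n (≤-trans (m≤m+n (suc d) r) d+1+r≤p[d])
    ... | s , d+1+s≡p[d] = trans (sym d+1+s≡p[d]) (cong (suc d +_) (≤-antisym s≤r r≤s))
      where
      r≤s : r ≤ s
      r≤s = +-cancelˡ-≤ (suc d) r s (subst (suc d + r ≤_) (sym d+1+s≡p[d]) d+1+r≤p[d])
      s≤r : s ≤ r
      s≤r = +-cancelˡ-≤ (suc k₁) s r (begin
        suc k₁ + s          ≡⟨ cong (_+ s) p[d+1]≡k₁+1 ⟨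
        p (suc d) + s       ≤⟨ increasingOn⇒+-≤ increasing-after s ≤-refl (subst (_≤ n) (sym d+1+s≡p[d]) p[d]≤n) ⟩
        p (suc d + s)       ≡⟨ cong p d+1+s≡p[d] ⟩
        p (p d)             ≡⟨ p[p[d]]≡d ⟩
        suc k₁ + r          ∎)
        where open ≤-Reasoning

    1≤n : 1 ≤ n
    1≤n = ≤-trans (s≤s z≤n) d<n

    head-fixes : ∀ {j} → 1 ≤ j → j ≤ k₁ → p j ≡ j
    head-fixes {j} 1≤j j≤k₁ = ≤-antisym p[j]≤j (inflationary 1≤j (≤-trans j≤k₁ k₁≤d))
      where
      k₁≤d : k₁ ≤ d
      k₁≤d = ≤-trans (n≤1+n k₁) (m≤m+n (suc k₁) r)
      inflationary : ∀ {i} → 1 ≤ i → i ≤ d → i ≤ p i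
      inflationary = increasingOn⇒inflationary increasing-before (proj₁ (bounded ≤-refl 1≤n))
      p[j]≤d : p j ≤ d
      p[j]≤d = ≤-pred (subst (p j <_) p[k₁+1]≡d+1
                 (increasingOn⇒< increasing-before 1≤j (s≤s j≤k₁) (m≤m+n (suc k₁) r)))
      p[j]≤j : p j ≤ j
      p[j]≤j = subst (p j ≤_) (involutive 1≤j (≤-trans (≤-trans j≤k₁ k₁≤d) (<⇒≤ d<n)))
                 (inflationary (proj₁ (bounded 1≤j (≤-trans (≤-trans j≤k₁ k₁≤d) (<⇒≤ d<n)))) p[j]≤d)

    tail-fixes : ∀ {j} → suc d + r < j → j ≤ n → p j ≡ j
    tail-fixes {j} last<j j≤n = ≤-antisym (deflationary d+1≤j j≤n) j≤p[j]
      where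
      deflationary : ∀ {i} → suc d ≤ i → i ≤ n → p i ≤ i
      deflationary = increasingOn⇒deflationary increasing-after (proj₂ (bounded 1≤n ≤-refl))
      d+1≤j : suc d ≤ j
      d+1≤j = ≤-trans (m≤m+n (suc d) r) (<⇒≤ last<j)
      d<p[j] : d < p j
      d<p[j] = begin-strict
        d                 ≡⟨ p[p[d]]≡d ⟨
        p (p d)           ≡⟨ cong p p[d]≡d+1+r ⟩
        p (suc d + r)     <⟨ increasingOn⇒< increasing-after (m≤m+n (suc d) r) last<j j≤n ⟩
        p j               ∎
        where open ≤-Reasoning
      j≤p[j] : j ≤ p j
      j≤p[j] = subst (_≤ p j) (involutive (≤-trans (s≤s z≤n) d+1≤j) j≤n)
                 (deflationary d<p[j] (proj₂ (bounded (≤-trans (s≤s z≤n) d+1≤j) j≤n)))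

    hasBlockPattern : HasBlockPattern p n
    hasBlockPattern with m≤n⇒∃[o]m+o≡n (subst (_≤ n) p[d]≡d+1+r p[d]≤n)
    ... | k₃ , last+k₃≡n = k₁ , suc r , k₃ , trans (cong (_+ k₃) tail-start) last+k₃≡n , record
      { head-fixed    = λ t<k₁ → head-fixes (s≤s z≤n) t<k₁
      ; rising-shift  = subst (λ j → Translates p (suc k₁) j (suc r)) (trans p[k₁+1]≡d+1 d+1≡)
          (increasingOn⇒translates increasing-before (s≤s z≤n) ≤-refl
            (≤-reflexive (trans p[d]≡d+1+r (cong (_+ r) (sym p[k₁+1]≡d+1)))))
      ; falling-shift = subst₂ (λ i j → Translates p i j (suc r)) d+1≡ p[d+1]≡k₁+1
          (increasingOn⇒translates increasing-after ≤-refl (subst (_≤ n) p[d]≡d+1+r p[d]≤n)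
            (≤-reflexive (begin
              p (suc d + r)   ≡⟨ cong p p[d]≡d+1+r ⟨
              p (p d)         ≡⟨ p[p[d]]≡d ⟩
              suc k₁ + r      ≡⟨ cong (_+ r) p[d+1]≡k₁+1 ⟨
              p (suc d) + r   ∎)))
      ; tail-fixed    = λ {t} t<k₃ → tail-fixes
          (subst (suc d + r <_) (cong (_+ t) (sym (cong suc tail-start))) (s≤s (m≤m+n (suc d + r) t)))
          (subst₂ _≤_ (cong (_+ t) (sym (cong suc tail-start))) last+k₃≡n (+-monoʳ-< (suc d + r) t<k₃))
      }
      where
      open ≡-Reasoning
      d+1≡ : suc d ≡ suc k₁ + suc r
      d+1≡ = cong suc (sym (+-suc k₁ r))
      tail-start : k₁ + suc r + suc r ≡ suc d + r
      tail-start = trans (cong (_+ suc r) (+-suc k₁ r)) (cong suc (+-suc (k₁ + r) r))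

  private
    ascent : ∀ {i} → 1 ≤ i → i < n → ¬ (p (suc i) < p i) → p i < p (suc i)
    ascent {i} 1≤i i<n p[i+1]≮p[i] = ≤∧≢⇒< (≮⇒≥ p[i+1]≮p[i]) λ p[i]≡p[i+1] → 1+n≢n (begin
      suc i          ≡⟨ involutive (s≤s z≤n) i<n ⟨
      p (p (suc i))  ≡⟨ cong p p[i]≡p[i+1] ⟨
      p (p i)        ≡⟨ involutive 1≤i (<⇒≤ i<n) ⟩
      i              ∎)
      where open ≡-Reasoning

  descent⇒hasBlockPattern : ∀ {d} → 1 ≤ d → d < n → p (suc d) < p d →
                            IncreasingOn p 1 d → IncreasingOn p (suc d) n → HasBlockPattern p n
  descent⇒hasBlockPattern {d} 1≤d d<n drop increasing-before increasing-after
    with m≤n⇒∃[o]m+o≡n (proj₁ (bounded (s≤s z≤n) d<n))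
       | m≤n⇒∃[o]m+o≡n (descent-value≤ 1≤d d<n drop increasing-after)
  ... | k₁ , 1+k₁≡p[d+1] | r , p[d+1]+r≡d with trans (cong (_+ r) 1+k₁≡p[d+1]) p[d+1]+r≡d
  ...   | refl = Descent.hasBlockPattern k₁ r increasing-before increasing-after d<n (sym 1+k₁≡p[d+1])

  atMostOneDescent⇒hasBlockPattern : (∀ i j → DescentOn p n i → DescentOn p n j → i ≡ j) → HasBlockPattern p n
  atMostOneDescent⇒hasBlockPattern unique with anyUpTo? (λ i → 1 ≤? i ×-dec p (suc i) <? p i) n
  ... | no no-descent = increasing⇒hasBlockPattern λ {i} 1≤i i<n →
          ascent 1≤i i<n (λ drop → no-descent (i , i<n , 1≤i , drop))
  ... | yes (d , d<n , 1≤d , drop) = descent⇒hasBlockPattern 1≤d d<n drop increasing-before increasing-after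
    where
    isDescent : ∀ {i} → 1 ≤ i → i < n → p (suc i) < p i → i ≡ d
    isDescent 1≤i i<n drop′ = unique _ d (1≤i , i<n , drop′) (1≤d , d<n , drop)
    increasing-before : IncreasingOn p 1 d
    increasing-before 1≤i i<d = ascent 1≤i (<-trans i<d d<n) λ drop′ →
      <-irrefl (isDescent 1≤i (<-trans i<d d<n) drop′) i<d
    increasing-after : IncreasingOn p (suc d) n
    increasing-after d<i i<n = ascent (≤-trans (s≤s z≤n) d<i) i<n λ drop′ →
      <-irrefl (sym (isDescent (≤-trans (s≤s z≤n) d<i) i<n drop′)) d<i

isPerm⇒length : ∀ {n π} → IsPerm n π → length π ≡ n
isPerm⇒length {n} π↭ = trans (↭-length π↭) (length-idp n)

isPerm⇒bounded : ∀ {n π} → IsPerm n π → ∀ {i} → 1 ≤ i → i ≤ length π → 1 ≤ at π i × at π i ≤ length π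
isPerm⇒bounded {n} {π} π↭ {suc i} _ i<len
  with ∈-consecutive⁻ 0 n (subst (_ ∈_) (idp≡consecutive n) (∈-resp-↭ π↭ (at-∈ π i<len)))
... | 0<x , x≤n = 0<x , subst (_ ≤_) (sym (isPerm⇒length π↭)) x≤n

grassmannianInvolution⇒blockPermutation : ∀ {n π} → IsPerm n π → Grassmannian π → Involution π →
  ∃[ k₁ ] ∃[ k₂ ] ∃[ k₃ ] (k₁ + 2 * k₂ + k₃ ≡ n × π ≡ blockPermutation k₁ k₂ k₃)
grassmannianInvolution⇒blockPermutation {n} {π} π↭ grassmannian involution
  with InvolutionOn.atMostOneDescent⇒hasBlockPattern (isPerm⇒bounded π↭) (λ {i} → involution i) grassmannian
... | k₁ , k₂ , k₃ , total , π-pattern =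
  k₁ , k₂ , k₃ , trans (+-2*-unfold k₁ k₂ k₃) (trans total (isPerm⇒length π↭)) ,
  at-extensional π (blockPermutation k₁ k₂ k₃) (sym (trans (length-blockPermutation k₁ k₂ k₃) total))
    (λ i< → blockPattern-unique π-pattern (blockPermutation-pattern k₁ k₂ k₃) (subst (_ <_) (sym total) i<))

pairsSummingTo : ℕ → List (ℕ × ℕ)
pairsSummingTo m = applyUpTo (λ a → a , m ∸ a) (suc m)

∈-pairsSummingTo⁺ : ∀ {a c} → (a , c) ∈ pairsSummingTo (a + c)
∈-pairsSummingTo⁺ {a} {c} =
  subst (λ x → (a , x) ∈ pairsSummingTo (a + c)) (m+n∸m≡n a c)
        (∈-applyUpTo⁺ (λ x → x , a + c ∸ x) (s≤s (m≤m+n a c)))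

∈-pairsSummingTo⁻ : ∀ {m a c} → (a , c) ∈ pairsSummingTo m → a + c ≡ m
∈-pairsSummingTo⁻ {m} a,c∈ with ∈-applyUpTo⁻ (λ a → a , m ∸ a) a,c∈
... | a , a<1+m , refl = m+[n∸m]≡n (≤-pred a<1+m)

pairsSummingTo-unique : ∀ m → Unique (pairsSummingTo m)
pairsSummingTo-unique m = Unique.applyUpTo⁺₁ (λ a → a , m ∸ a) (suc m) (λ i<j _ → <⇒≢ i<j ∘ cong proj₁)

length-pairsSummingTo : ∀ m → length (pairsSummingTo m) ≡ suc m
length-pairsSummingTo m = length-applyUpTo (λ a → a , m ∸ a) (suc m)

widen : ℕ × ℕ × ℕ → ℕ × ℕ × ℕ
widen (k₁ , m , k₃) = k₁ , suc m , k₃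

unitMiddle : ℕ × ℕ → ℕ × ℕ × ℕ
unitMiddle (k₁ , k₃) = k₁ , 0 , k₃

-- Lists (k₁, k₂ ∸ 1, k₃) for the triples with k₁ + 2 k₂ + k₃ = n and k₂ ≥ 1: either k₂ = 1, or
-- removing one entry from each middle block leaves such a triple for n - 2.
blockShapes : ℕ → List (ℕ × ℕ × ℕ)
blockShapes zero          = []
blockShapes (suc zero)    = []
blockShapes (suc (suc n)) = map widen (blockShapes n) ++ map unitMiddle (pairsSummingTo n)

+-2*-suc : ∀ a b c → a + 2 * suc b + c ≡ suc (suc (a + 2 * b + c))
+-2*-suc = solve-∀

∈-blockShapes⁻ : ∀ n {k₁ m k₃} → (k₁ , m , k₃) ∈ blockShapes n → k₁ + 2 * suc m + k₃ ≡ n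
∈-blockShapes⁻ (suc (suc n)) k∈ with ∈-++⁻ (map widen (blockShapes n)) k∈
... | inj₁ k∈widened with ∈-map⁻ widen k∈widened
...   | (a , m , c) , k′∈ , refl = trans (+-2*-suc a (suc m) c) (cong (suc ∘ suc) (∈-blockShapes⁻ n k′∈))
∈-blockShapes⁻ (suc (suc n)) k∈ | inj₂ k∈unitMiddle with ∈-map⁻ unitMiddle k∈unitMiddle
...   | (a , c) , a,c∈ , refl =
        trans (+-2*-suc a 0 c) (cong (suc ∘ suc) (trans (cong (_+ c) (+-identityʳ a)) (∈-pairsSummingTo⁻ a,c∈)))

∈-blockShapes⁺ : ∀ k₁ m k₃ → (k₁ , m , k₃) ∈ blockShapes (k₁ + 2 * suc m + k₃)
∈-blockShapes⁺ k₁ zero k₃ rewrite +-2*-suc k₁ 0 k₃ | +-identityʳ k₁ =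
  ∈-++⁺ʳ (map widen (blockShapes (k₁ + k₃))) (∈-map⁺ unitMiddle ∈-pairsSummingTo⁺)
∈-blockShapes⁺ k₁ (suc m) k₃ rewrite +-2*-suc k₁ (suc m) k₃ =
  ∈-++⁺ˡ (∈-map⁺ widen (∈-blockShapes⁺ k₁ m k₃))

blockShapes-unique : ∀ n → Unique (blockShapes n)
blockShapes-unique zero          = []
blockShapes-unique (suc zero)    = []
blockShapes-unique (suc (suc n)) =
  Unique.++⁺ (Unique.map⁺ widen-injective (blockShapes-unique n))
             (Unique.map⁺ unitMiddle-injective (pairsSummingTo-unique n))
             disjoint
  where
  widen-injective : ∀ {x y} → widen x ≡ widen y → x ≡ y
  widen-injective {_ , _ , _} refl = refl
  unitMiddle-injective : ∀ {x y} → unitMiddle x ≡ unitMiddle y → x ≡ y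
  unitMiddle-injective {_ , _} refl = refl
  disjoint : ∀ {k} → ¬ (k ∈ map widen (blockShapes n) × k ∈ map unitMiddle (pairsSummingTo n))
  disjoint (k∈widened , k∈unitMiddle) with ∈-map⁻ widen k∈widened | ∈-map⁻ unitMiddle k∈unitMiddle
  ... | _ , _ , refl | _ , _ , ()

length-blockShapes : ∀ n → length (blockShapes (suc (suc n))) ≡ length (blockShapes n) + suc n
length-blockShapes n = begin
  length (map widen (blockShapes n) ++ map unitMiddle (pairsSummingTo n))
    ≡⟨ length-++ (map widen (blockShapes n)) ⟩
  length (map widen (blockShapes n)) + length (map unitMiddle (pairsSummingTo n))
    ≡⟨ cong₂ _+_ (length-map widen (blockShapes n)) (length-map unitMiddle (pairsSummingTo n)) ⟩
  length (blockShapes n) + length (pairsSummingTo n)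
    ≡⟨ cong (length (blockShapes n) +_) (length-pairsSummingTo n) ⟩
  length (blockShapes n) + suc n ∎
  where open ≡-Reasoning

-- Odd and even n at once: the parity bit n % 2 accounts for the difference between n² + 3 and n² + 4.
length-blockShapes-closed : ∀ n → 4 * suc (length (blockShapes n)) + n % 2 ≡ n * n + 4
length-blockShapes-closed zero          = refl
length-blockShapes-closed (suc zero)    = refl
length-blockShapes-closed (suc (suc n)) = begin
  4 * suc (length (blockShapes (2 + n))) + (2 + n) % 2
    ≡⟨ cong₂ (λ l b → 4 * suc l + b) (length-blockShapes n) (trans (cong (_% 2) (+-comm 2 n)) ([m+n]%n≡m%n n 2)) ⟩
  4 * suc (length (blockShapes n) + suc n) + n % 2
    ≡⟨ step (length (blockShapes n)) n (n % 2) ⟩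
  (4 * suc (length (blockShapes n)) + n % 2) + 4 * suc n
    ≡⟨ cong (_+ 4 * suc n) (length-blockShapes-closed n) ⟩
  (n * n + 4) + 4 * suc n
    ≡⟨ square (n) ⟩
  suc (suc n) * suc (suc n) + 4 ∎
  where
  open ≡-Reasoning
  step : ∀ l n b → 4 * suc (l + suc n) + b ≡ (4 * suc l + b) + 4 * suc n
  step = solve-∀
  square : ∀ n → (n * n + 4) + 4 * suc n ≡ suc (suc n) * suc (suc n) + 4
  square = solve-∀

blockPermutationOf : ℕ × ℕ × ℕ → List ℕ
blockPermutationOf (k₁ , m , k₃) = blockPermutation k₁ (suc m) k₃

grassmannianInvolutions : ℕ → List (List ℕ)
grassmannianInvolutions n = idp n ∷ map blockPermutationOf (blockShapes n)

grassmannianInvolutions-unique : ∀ n → Unique (grassmannianInvolutions n)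
grassmannianInvolutions-unique n =
  All.tabulate idp∉ ∷ Unique.map⁺ (λ {x} {y} → injective x y) (blockShapes-unique n)
  where
  injective : ∀ x y → blockPermutationOf x ≡ blockPermutationOf y → x ≡ y
  injective (_ , _ , _) (_ , _ , _) = blockPermutation-injective
  idp∉ : ∀ {π} → π ∈ map blockPermutationOf (blockShapes n) → idp n ≢ π
  idp∉ π∈ with ∈-map⁻ blockPermutationOf π∈
  ... | (k₁ , m , k₃) , k∈ , refl = idp≢blockPermutation {n} {k₁} {m} {k₃} (∈-blockShapes⁻ n k∈)

∈-grassmannianInvolutions : ∀ n π →
  π ∈ grassmannianInvolutions n ⇔ (IsPerm n π × Grassmannian π × Involution π)
∈-grassmannianInvolutions n π = mk⇔ to from
  where
  to : π ∈ grassmannianInvolutions n → IsPerm n π × Grassmannian π × Involution π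
  to (here refl) = ↭-refl ,
    subst Grassmannian (sym (idp≡blockPermutation n)) (blockPermutation-grassmannian n 0 0) ,
    subst Involution (sym (idp≡blockPermutation n)) (blockPermutation-involution n 0 0)
  to (there π∈) with ∈-map⁻ blockPermutationOf π∈
  ... | (k₁ , m , k₃) , k∈ , refl =
    subst (λ n → IsPerm n (blockPermutation k₁ (suc m) k₃)) (∈-blockShapes⁻ n k∈)
          (blockPermutation-isPerm k₁ (suc m) k₃) ,
    blockPermutation-grassmannian k₁ (suc m) k₃ , blockPermutation-involution k₁ (suc m) k₃
  from : IsPerm n π × Grassmannian π × Involution π → π ∈ grassmannianInvolutions n
  from (π↭ , grassmannian , involution) with grassmannianInvolution⇒blockPermutation π↭ grassmannian involution
  ... | k₁ , zero  , k₃ , refl , refl =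
    here (trans (blockPermutation-emptyMiddle k₁ k₃) (cong (λ x → idp (x + k₃)) (sym (+-identityʳ k₁))))
  ... | k₁ , suc m , k₃ , refl , refl = there (∈-map⁺ blockPermutationOf (∈-blockShapes⁺ k₁ m k₃))

4*length-grassmannianInvolutions : ∀ n → 4 * length (grassmannianInvolutions n) + n % 2 ≡ n * n + 4
4*length-grassmannianInvolutions n =
  trans (cong (λ l → 4 * suc l + n % 2) (length-map blockPermutationOf (blockShapes n)))
        (length-blockShapes-closed n)

length-grassmannianInvolutions-odd : ∀ n → n % 2 ≡ 1 → 4 * length (grassmannianInvolutions n) ≡ n * n + 3
length-grassmannianInvolutions-odd n odd = suc-injective (begin
  suc (4 * length L)        ≡⟨ +-comm 1 (4 * length L) ⟩
  4 * length L + 1          ≡⟨ cong (4 * length L +_) odd ⟨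
  4 * length L + n % 2      ≡⟨ 4*length-grassmannianInvolutions n ⟩
  n * n + 4                 ≡⟨ +-suc (n * n) 3 ⟩
  suc (n * n + 3)           ∎)
  where
  open ≡-Reasoning
  L = grassmannianInvolutions n

length-grassmannianInvolutions-even : ∀ n → n % 2 ≡ 0 → 4 * length (grassmannianInvolutions n) ≡ n * n + 4
length-grassmannianInvolutions-even n even = begin
  4 * length L              ≡⟨ +-identityʳ (4 * length L) ⟨
  4 * length L + 0          ≡⟨ cong (4 * length L +_) even ⟨
  4 * length L + n % 2      ≡⟨ 4*length-grassmannianInvolutions n ⟩
  n * n + 4                 ∎
  where
  open ≡-Reasoning
  L = grassmannianInvolutions n

mainTheorem3 : (∀ (n : ℕ) (π : List ℕ) → IsPerm n π → Grassmannian π →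
                  (Involution π ⇔
                    (∃[ k₁ ] ∃[ k₂ ] ∃[ k₃ ] ((k₁ + 2 * k₂ + k₃ ≡ n) ×
                      (π ≡ idp k₁ ⊕ (idp k₂ ⊖ idp k₂) ⊕ idp k₃)))))
               × (∀ (n : ℕ) → ∃[ L ] (Unique L
                    × (∀ (π : List ℕ) → (π ∈ L ⇔ (IsPerm n π × Grassmannian π × Involution π)))
                    × ((n % 2 ≡ 1 → 4 * length L ≡ n * n + 3)
                       × (n % 2 ≡ 0 → 4 * length L ≡ n * n + 4))))
mainTheorem3 =
  (λ n π π↭ grassmannian → mk⇔
    (grassmannianInvolution⇒blockPermutation π↭ grassmannian)
    (λ { (k₁ , k₂ , k₃ , _ , refl) → blockPermutation-involution k₁ k₂ k₃ })) ,
  (λ n → grassmannianInvolutions n , grassmannianInvolutions-unique n , ∈-grassmannianInvolutions n ,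
         length-grassmannianInvolutions-odd n , length-grassmannianInvolutions-even n)
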